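{- Let $G$ be a group, let $H$ be a finite subgroup of $G$, and let $\mathcal{X}$ and $\mathcal{Y}$ be finite sets of prime numbers. (i) If no prime divisor of $|H|$ lies in $\mathcal{X}$, then $\vec{\mathcal{P}}_{ -\mathcal{X}}(H)=\vec{\mathcal{P}}(H)$. (ii) If every prime divisor of $|H|$ lies in $\mathcal{X}$, then $\vec{\mathcal{P}}_{ -\mathcal{X}}(H)$ is the disjoint union of directed cliques, one on the set of generators of each cyclic subgroup of $H$ (with no edges between different such sets). (iii) The edge set of $\vec{\mathcal{P}}_{ -(\mathcal{X}\cup\mathcal{Y})}(H)$ is the intersection of the edge sets of $\vec{\mathcal{P}}_{ -\mathcal{X}}(H)$ and $\vec{\mathcal{P}}_{ -\mathcal{Y}}(H)$.
   Context: For a group $H$, the directed power graph $\vec{\mathcal{P}}(H)$ has vertex set $H$ and a directed edge from $g$ to $h$ whenever $h\neq g$ and $h=g^k$ for some positive integer $k$. For a set $\mathcal{X}$ of positive integers, the directed $\mathcal{X}$-excluded power graph $\vec{\mathcal{P}}_{ -\mathcal{X}}(H)$ has vertex set $H$ and a directed edge from $g$ to $h$ whenever $h\neq g$ and $h=g^k$ for some positive integer $k$ not divisible by any element of $\mathcal{X}$. A directed clique is a set of vertices with a directed edge from each vertex to every other vertex of the set. -}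

module Defs where

open import Level using (Level; _⊔_; suc)
open import Algebra.Bundles using (Group)
open import Data.Nat using (ℕ; zero; _≥_) renaming (suc to sucℕ)
open import Data.Nat.Divisibility using (_∣_)
open import Data.Integer using (ℤ; +_; -[1+_])
open import Data.List using (List; length)
open import Data.List.Membership.Propositional using (_∈_)
open import Data.List.Relation.Unary.Any using (Any)
open import Data.List.Relation.Unary.AllPairs using (AllPairs)
open import Data.Product using (Σ; ∃; _×_)
open import Relation.Nullary using (¬_)

module _ {c ℓ : Level} (G : Group c ℓ) where
  open Group G

  pow : Carrier → ℕ → Carrier
  pow g zero = ε
  pow g (sucℕ k) = g ∙ pow g k

  powℤ : Carrier → ℤ → Carrier
  powℤ g (+ n) = pow g n
  powℤ g -[1+ n ] = (pow g (sucℕ n)) ⁻¹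

  InCyc : Carrier → Carrier → Set ℓ
  InCyc g x = Σ ℤ λ z → x ≈ powℤ g z

  SameCyclic : Carrier → Carrier → Set (c ⊔ ℓ)
  SameCyclic g h = ∀ x → (InCyc g x → InCyc h x) × (InCyc h x → InCyc g x)

  record FiniteSubgroup (p : Level) : Set (c ⊔ ℓ ⊔ suc p) where
    field
      InH      : Carrier → Set p
      InH-resp : ∀ {x y} → x ≈ y → InH x → InH y
      InH-ε    : InH ε
      InH-∙    : ∀ {x y} → InH x → InH y → InH (x ∙ y)
      InH-⁻¹   : ∀ {x} → InH x → InH (x ⁻¹)
      elems    : List Carrier
      elems-InH   : ∀ {x} → x ∈ elems → InH x
      elems-cover : ∀ {x} → InH x → Any (x ≈_) elems
      elems-distinct : AllPairs (λ x y → ¬ (x ≈ y)) elems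

    order : ℕ
    order = length elems

  Admissible : List ℕ → ℕ → Set
  Admissible 𝒳 k = ∀ x → x ∈ 𝒳 → ¬ (x ∣ k)

  PowEdge : ∀ {p} → FiniteSubgroup p → Carrier → Carrier → Set (ℓ ⊔ p)
  PowEdge H g h = InH g × InH h × ¬ (h ≈ g) × Σ ℕ λ k → k ≥ 1 × h ≈ pow g k
    where open FiniteSubgroup H

  ExclEdge : ∀ {p} → FiniteSubgroup p → List ℕ → Carrier → Carrier → Set (ℓ ⊔ p)
  ExclEdge H 𝒳 g h = InH g × InH h × ¬ (h ≈ g)
                     × Σ ℕ λ k → k ≥ 1 × Admissible 𝒳 k × h ≈ pow g k
    where open FiniteSubgroup H

-- If h = gᵏ and gᵈ = ε, and no prime of 𝒳 divides
-- both k and d, then h = g^(k + t·d) where t is the product of the primes of 𝒳 not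
-- dividing k, and no prime of 𝒳 divides k + t·d. Lagrange's theorem for ⟨g⟩ (right
-- translation by g is a free action of ℤ/ord(g) on H) makes |H| such a period in (i).
-- In (ii) an admissible k is coprime to |H|, so by Bézout g is a power of h; conversely
-- h = gᵃ and g = hᵇ make ab − 1 a period of g coprime to a. In (iii) two exponents
-- k₁, k₂ of h give the period |k₁ − k₂|, and a prime of 𝒳 ∪ 𝒴 dividing k₁ and |k₁ − k₂|
-- would divide both k₁ and k₂, which admissibility forbids.
{-# OPTIONS --safe #-}
module Submission where

open import Defs
open import Level using (Level)
open import Algebra.Bundles using (Group)
open import Data.Fin as Fin using (Fin; zero; suc)
open import Data.Fin.Properties using (pigeonhole; nonZeroIndex)
open import Data.Integer using (+_; -[1+_])
open import Data.List using (List; []; _∷_; _++_; filter; lookup)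
open import Data.List.Membership.Propositional.Properties
  using (∈-lookup; ∈-filter⁺; ∈-filter⁻; ∈-++⁺ˡ; ∈-++⁺ʳ; ∈-++⁻)
open import Data.List.Relation.Unary.All as All using (All; _∷_)
open import Data.List.Relation.Unary.All.Properties using (filter⁺; ++⁺)
open import Data.List.Relation.Unary.AllPairs using (_∷_)
import Data.List.Relation.Unary.Any as Any
open import Data.List.Relation.Unary.Any.Properties using (lookup-index)
open import Data.List.Relation.Unary.Unique.Setoid using (Unique)
open import Data.Nat
  using ( ℕ; zero; suc; _+_; _*_; _∸_; _<_; _≤_; _≥_; z≤n; s≤s; pred; _%_; _/_
        ; NonZero; >-nonZero; ≢-nonZero; >-nonZero⁻¹)
open import Data.Nat.Properties
open import Data.Nat.Coprimality using (Coprime; coprime-Bézout)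
open import Data.Nat.Divisibility
open import Data.Nat.DivMod using (m≡m%n+[m/n]*n; m%n<n)
open import Data.Nat.GCD using (module Bézout)
open import Data.Nat.Induction using (<-wellFounded)
open import Data.Nat.ListAction using (product)
open import Data.Nat.ListAction.Properties using (∈⇒∣product)
open import Data.Nat.Primality using (Prime; euclidsLemma; prime[2]; ¬prime[1])
open import Data.Nat.Primality.Factorisation using (factorise; factorisationHasAllPrimeFactors)
open import Data.Product using (∃; Σ; _×_; _,_; proj₁; proj₂)
open import Data.Sum using (_⊎_; inj₁; inj₂; [_,_]′)
open import Function.Base using (_∘_)
open import Function.Bundles using (_⇔_; mk⇔; Equivalence)
open import Function.Properties.Equivalence using () renaming (trans to ⇔-trans)
open import Induction.WellFounded using (Acc; acc)
open import Relation.Binary.Bundles using (Setoid)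
open import Relation.Binary.PropositionalEquality as ≡ using (_≡_; _≢_)
open import Relation.Nullary using (¬_; Dec; yes; no; ¬?; contradiction)
import Relation.Nullary.Decidable as Dec
open import Relation.Unary using (Pred; Decidable)

module _ where
  open import Data.Fin.Subset
  open import Data.Fin.Subset.Properties
  open import Data.Vec using (_∷_; []; here; there)
  open ≡
  open ≡-Reasoning

  ∣p∣≡∣p∩q∣+∣p∩∁q∣ : ∀ {n} (p q : Subset n) → ∣ p ∣ ≡ ∣ p ∩ q ∣ + ∣ p ∩ ∁ q ∣
  ∣p∣≡∣p∩q∣+∣p∩∁q∣ []            []            = refl
  ∣p∣≡∣p∩q∣+∣p∩∁q∣ (inside  ∷ p) (inside  ∷ q) = cong suc (∣p∣≡∣p∩q∣+∣p∩∁q∣ p q)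
  ∣p∣≡∣p∩q∣+∣p∩∁q∣ (inside  ∷ p) (outside ∷ q) =
    trans (cong suc (∣p∣≡∣p∩q∣+∣p∩∁q∣ p q)) (sym (+-suc _ _))
  ∣p∣≡∣p∩q∣+∣p∩∁q∣ (outside ∷ p) (_       ∷ q) = ∣p∣≡∣p∩q∣+∣p∩∁q∣ p q

  x∉p⇒∣p∪⁅x⁆∣≡1+∣p∣ : ∀ {n} {x : Fin n} {p : Subset n} → x ∉ p → ∣ p ∪ ⁅ x ⁆ ∣ ≡ suc ∣ p ∣
  x∉p⇒∣p∪⁅x⁆∣≡1+∣p∣ {x = zero}  {inside  ∷ p} x∉p = contradiction here x∉p
  x∉p⇒∣p∪⁅x⁆∣≡1+∣p∣ {x = zero}  {outside ∷ p} x∉p = cong (suc ∘ ∣_∣) (∪-identityʳ p)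
  x∉p⇒∣p∪⁅x⁆∣≡1+∣p∣ {x = suc x} {inside  ∷ p} x∉p = cong suc (x∉p⇒∣p∪⁅x⁆∣≡1+∣p∣ (x∉p ∘ there))
  x∉p⇒∣p∪⁅x⁆∣≡1+∣p∣ {x = suc x} {outside ∷ p} x∉p = x∉p⇒∣p∪⁅x⁆∣≡1+∣p∣ (x∉p ∘ there)

  module FreeAction {n m : ℕ} .{{_ : NonZero m}} (act : Fin n → ℕ → Fin n)
    (act-+ : ∀ x i j → act (act x i) j ≡ act x (i + j))
    (act≡⇔∣ : ∀ x j → act x j ≡ x ⇔ m ∣ j)
    where

    open Equivalence

    act-∣ : ∀ x {j} → m ∣ j → act x j ≡ x
    act-∣ x = from (act≡⇔∣ x _)

    act-% : ∀ x j → act x (j % m) ≡ act x j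
    act-% x j = begin
      act x (j % m)                     ≡⟨ act-∣ (act x (j % m)) (n∣m*n (j / m)) ⟨
      act (act x (j % m)) (j / m * m)   ≡⟨ act-+ x (j % m) (j / m * m) ⟩
      act x (j % m + j / m * m)         ≡⟨ cong (act x) (m≡m%n+[m/n]*n j m) ⟨
      act x j                           ∎

    orbitUpTo : Fin n → ℕ → Subset n
    orbitUpTo x zero    = ⊥
    orbitUpTo x (suc k) = orbitUpTo x k ∪ ⁅ act x k ⁆

    orbit : Fin n → Subset n
    orbit x = orbitUpTo x m

    act∈orbitUpTo : ∀ x {i k} → i < k → act x i ∈ orbitUpTo x k
    act∈orbitUpTo x {i} {suc k} i<1+k with m≤n⇒m<n∨m≡n (≤-pred i<1+k)
    ... | inj₁ i<k  = x∈p∪q⁺ (inj₁ (act∈orbitUpTo x i<k))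
    ... | inj₂ refl = x∈p∪q⁺ (inj₂ (x∈⁅x⁆ (act x i)))

    ∈orbitUpTo⇒ : ∀ x {y} k → y ∈ orbitUpTo x k → ∃ λ i → i < k × act x i ≡ y
    ∈orbitUpTo⇒ x zero    y∈⊥ = contradiction y∈⊥ ∉⊥
    ∈orbitUpTo⇒ x (suc k) y∈  with x∈p∪q⁻ (orbitUpTo x k) ⁅ act x k ⁆ y∈
    ... | inj₁ y∈orbit = let i , i<k , eq = ∈orbitUpTo⇒ x k y∈orbit in i , m<n⇒m<1+n i<k , eq
    ... | inj₂ y∈⁅x⁆  = k , n<1+n k , sym (x∈⁅y⁆⇒x≡y _ y∈⁅x⁆)

    act∉orbitUpTo : ∀ x {k} → k < m → act x k ∉ orbitUpTo x k
    act∉orbitUpTo x {k} k<m act∈ with ∈orbitUpTo⇒ x k act∈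
    ... | i , i<k , act-i≡act-k =
      >⇒∤ {{≢-nonZero (m>n⇒m∸n≢0 i<k)}} (≤-<-trans (m∸n≤m k i) k<m) m∣k∸i
      where
      m∣k∸i : m ∣ k ∸ i
      m∣k∸i = to (act≡⇔∣ (act x i) (k ∸ i)) (begin
        act (act x i) (k ∸ i) ≡⟨ act-+ x i (k ∸ i) ⟩
        act x (i + (k ∸ i))   ≡⟨ cong (act x) (m+[n∸m]≡n (<⇒≤ i<k)) ⟩
        act x k               ≡⟨ act-i≡act-k ⟨
        act x i               ∎)

    ∣orbitUpTo∣≡k : ∀ x {k} → k ≤ m → ∣ orbitUpTo x k ∣ ≡ k
    ∣orbitUpTo∣≡k x {zero}  _     = ∣⊥∣≡0 n
    ∣orbitUpTo∣≡k x {suc k} 1+k≤m = trans (x∉p⇒∣p∪⁅x⁆∣≡1+∣p∣ (act∉orbitUpTo x 1+k≤m))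
                                          (cong suc (∣orbitUpTo∣≡k x (<⇒≤ 1+k≤m)))

    act∈orbit : ∀ x j → act x j ∈ orbit x
    act∈orbit x j = subst (_∈ orbit x) (act-% x j) (act∈orbitUpTo x (m%n<n j m))

    Closed : Subset n → Set
    Closed S = ∀ {y} j → y ∈ S → act y j ∈ S

    orbit⊆ : ∀ {S x} → Closed S → x ∈ S → orbit x ⊆ S
    orbit⊆ closed x∈S y∈orbit with ∈orbitUpTo⇒ _ m y∈orbit
    ... | i , _ , refl = closed i x∈S

    act-inverse : ∀ y j → act (act y j) (pred m * j) ≡ y
    act-inverse y j = trans (act-+ y j (pred m * j))
      (act-∣ y (subst (λ k → m ∣ k * j) (sym (suc-pred m)) (m∣m*n j)))

    act∈orbit⇒∈orbit : ∀ x y j → act y j ∈ orbit x → y ∈ orbit x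
    act∈orbit⇒∈orbit x y j act-y-j∈orbit
      with i , _ , act-x-i≡act-y-j ← ∈orbitUpTo⇒ x m act-y-j∈orbit =
      subst (_∈ orbit x) (begin
        act x (i + pred m * j)        ≡⟨ act-+ x i (pred m * j) ⟨
        act (act x i) (pred m * j)    ≡⟨ cong (λ z → act z (pred m * j)) act-x-i≡act-y-j ⟩
        act (act y j) (pred m * j)    ≡⟨ act-inverse y j ⟩
        y                             ∎) (act∈orbit x (i + pred m * j))

    ∖orbit-closed : ∀ {S} x → Closed S → Closed (S ∩ ∁ (orbit x))
    ∖orbit-closed {S} x closed {y} j y∈S∖orbit
      with y∈S , y∈∁orbit ← x∈p∩q⁻ S (∁ (orbit x)) y∈S∖orbit =
      x∈p∩q⁺ (closed j y∈S , x∉p⇒x∈∁p (x∈∁p⇒x∉p y∈∁orbit ∘ act∈orbit⇒∈orbit x y j))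

    ∣closed∣≡m+∣∖orbit∣ : ∀ {S x} → Closed S → x ∈ S → ∣ S ∣ ≡ m + ∣ S ∩ ∁ (orbit x) ∣
    ∣closed∣≡m+∣∖orbit∣ {S} {x} closed x∈S = begin
      ∣ S ∣                     ≡⟨ ∣p∣≡∣p∩q∣+∣p∩∁q∣ S (orbit x) ⟩
      ∣ S ∩ orbit x ∣ + rest    ≡⟨ cong (λ p → ∣ p ∣ + rest) S∩orbit≡orbit ⟩
      ∣ orbit x ∣ + rest        ≡⟨ cong (_+ rest) (∣orbitUpTo∣≡k x ≤-refl) ⟩
      m + rest                  ∎
      where
      rest = ∣ S ∩ ∁ (orbit x) ∣
      S∩orbit≡orbit : S ∩ orbit x ≡ orbit x
      S∩orbit≡orbit = ⊆-antisym (p∩q⊆q S (orbit x)) (λ y∈O → x∈p∩q⁺ (orbit⊆ closed x∈S y∈O , y∈O))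

    m∣∣closed∣ : ∀ S → Acc _<_ ∣ S ∣ → Closed S → m ∣ ∣ S ∣
    m∣∣closed∣ S (acc smaller) closed with nonempty? S
    ... | no S-empty    = subst (m ∣_) (sym (trans (cong ∣_∣ (Empty-unique S-empty)) (∣⊥∣≡0 n)))
                                (m ∣0)
    ... | yes (x , x∈S) = subst (m ∣_) (sym size) (∣m∣n⇒∣m+n ∣-refl m∣∣∖orbit∣)
      where
      size : ∣ S ∣ ≡ m + ∣ S ∩ ∁ (orbit x) ∣
      size = ∣closed∣≡m+∣∖orbit∣ closed x∈S
      m∣∣∖orbit∣ : m ∣ ∣ S ∩ ∁ (orbit x) ∣
      m∣∣∖orbit∣ = m∣∣closed∣ (S ∩ ∁ (orbit x))
        (smaller (subst (∣ S ∩ ∁ (orbit x) ∣ <_) (sym size) (m<n+m _ (>-nonZero⁻¹ m))))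
        (∖orbit-closed x closed)

    m∣n : m ∣ n
    m∣n = subst (m ∣_) (∣⊤∣≡n n) (m∣∣closed∣ ⊤ (<-wellFounded _) (λ _ _ → ∈⊤))

open import Data.List.Membership.Propositional using (_∈_; _∉_)

module _ {p} {P : Pred ℕ p} (P? : Decidable P) where

  private
    search : ∀ v → (∃ λ m → P m × ∀ {j} → j < m → ¬ P j) ⊎ (∀ {j} → j < v → ¬ P j)
    search zero = inj₂ λ ()
    search (suc v) with search v | P? v
    ... | inj₁ least | _     = inj₁ least
    ... | inj₂ none  | yes q = inj₁ (v , q , none)
    ... | inj₂ none  | no ¬q =
      inj₂ λ j<1+v → [ none , (λ { ≡.refl → ¬q }) ]′ (m≤n⇒m<n∨m≡n (≤-pred j<1+v))

  least-witness : ∀ {k} → P k → ∃ λ m → P m × ∀ {j} → j < m → ¬ P j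
  least-witness {k} pk with search (suc k)
  ... | inj₁ least = least
  ... | inj₂ none  = contradiction pk (none (n<1+n k))

prime-divisor : ∀ {i} .{{_ : NonZero i}} → i ≢ 1 → ∃ λ q → Prime q × q ∣ i
prime-divisor {i} i≢1 with factorise i
... | record { factors = [] ; isFactorisation = i≡1 } = contradiction i≡1 i≢1
... | record { factors = q ∷ qs ; isFactorisation = i≡q*qs ; factorsPrime = q-prime ∷ _ } =
  q , q-prime , ≡.subst (q ∣_) (≡.sym i≡q*qs) (m∣m*n (product qs))

no-common-prime⇒coprime : ∀ {m n} → (∀ {q} → Prime q → q ∣ m → q ∤ n) → Coprime m n
no-common-prime⇒coprime coprime {zero} (0∣m , 0∣n) =
  contradiction (∣-trans (2 ∣0) 0∣n) (coprime prime[2] (∣-trans (2 ∣0) 0∣m))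
no-common-prime⇒coprime coprime {suc i} (i∣m , i∣n) with suc i ≟ 1
... | yes i≡1 = i≡1
... | no  i≢1 with q , q-prime , q∣i ← prime-divisor i≢1 =
  contradiction (∣-trans q∣i i∣n) (coprime q-prime (∣-trans q∣i i∣m))

admissible-shift : ∀ {𝒳 k d} → All Prime 𝒳 → (∀ {q} → q ∈ 𝒳 → q ∣ k → q ∤ d) →
                   ∃ λ t → ∀ q → q ∈ 𝒳 → q ∤ k + t * d
admissible-shift {𝒳} {k} {d} primes coprime = t , avoids
  where
  ∤k? = λ q → ¬? (q ∣? k)
  t = product (filter ∤k? 𝒳)
  avoids : ∀ q → q ∈ 𝒳 → q ∤ k + t * d
  avoids q q∈𝒳 q∣k+td with q ∣? k
  ... | yes q∣k with euclidsLemma t d (All.lookup primes q∈𝒳) (∣m+n∣m⇒∣n q∣k+td q∣k)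
  ...   | inj₂ q∣d = coprime q∈𝒳 q∣k q∣d
  ...   | inj₁ q∣t =
    let q∈filter = factorisationHasAllPrimeFactors (All.lookup primes q∈𝒳) q∣t (filter⁺ ∤k? primes)
    in proj₂ (∈-filter⁻ ∤k? {xs = 𝒳} q∈filter) q∣k
  avoids q q∈𝒳 q∣k+td | no q∤k =
    q∤k (∣m+n∣m⇒∣n (≡.subst (q ∣_) (+-comm k (t * d)) q∣k+td)
           (∣m⇒∣m*n d (∈⇒∣product (∈-filter⁺ ∤k? q∈𝒳 q∤k))))

lookup-injective : ∀ {a r} (S : Setoid a r) {xs} → Unique S xs →
                   ∀ {i j} → Setoid._≈_ S (lookup xs i) (lookup xs j) → i ≡ j
lookup-injective S (_    ∷ _)      {zero}  {zero}  _     = ≡.refl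
lookup-injective S (x≉xs ∷ _)      {zero}  {suc j} x≈xⱼ = contradiction x≈xⱼ (All.lookup x≉xs (∈-lookup j))
lookup-injective S (x≉xs ∷ _)      {suc i} {zero}  xᵢ≈x =
  contradiction (Setoid.sym S xᵢ≈x) (All.lookup x≉xs (∈-lookup i))
lookup-injective S (_    ∷ unique) {suc i} {suc j} xᵢ≈xⱼ = ≡.cong suc (lookup-injective S unique xᵢ≈xⱼ)

module _ {c ℓ} (G : Group c ℓ) where
  open Group G
  open import Algebra.Properties.Group G using (identityʳ-unique; inverseˡ-unique; inverseʳ-unique)
  open import Algebra.Properties.Monoid.Mult monoid
    using (×-homo-+; ×-assocˡ; ×-congʳ) renaming (_×_ to _·_)
  open import Relation.Binary.Reasoning.Setoid setoid

  infixr 8 _^_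
  _^_ : Carrier → ℕ → Carrier
  _^_ = pow G

  ^≡· : ∀ g k → g ^ k ≡ k · g
  ^≡· g zero    = ≡.refl
  ^≡· g (suc k) = ≡.cong (g ∙_) (^≡· g k)

  ^-homo-+ : ∀ g a b → g ^ (a + b) ≈ g ^ a ∙ g ^ b
  ^-homo-+ g a b rewrite ^≡· g (a + b) | ^≡· g a | ^≡· g b = ×-homo-+ g a b

  ^-* : ∀ g a b → g ^ (a * b) ≈ (g ^ b) ^ a
  ^-* g a b rewrite ^≡· g (a * b) | ^≡· (g ^ b) a | ^≡· g b = sym (×-assocˡ g a b)

  ^-congˡ : ∀ {x y} k → x ≈ y → x ^ k ≈ y ^ k
  ^-congˡ {x} {y} k x≈y rewrite ^≡· x k | ^≡· y k = ×-congʳ k x≈y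

  ε^ : ∀ k → ε ^ k ≈ ε
  ε^ zero    = refl
  ε^ (suc k) = trans (identityˡ _) (ε^ k)

  ^-periodic : ∀ {g d} → g ^ d ≈ ε → ∀ k t → g ^ (k + t * d) ≈ g ^ k
  ^-periodic {g} {d} g^d≈ε k t = begin
    g ^ (k + t * d)        ≈⟨ ^-homo-+ g k (t * d) ⟩
    g ^ k ∙ g ^ (t * d)    ≈⟨ ∙-congˡ (^-* g t d) ⟩
    g ^ k ∙ (g ^ d) ^ t    ≈⟨ ∙-congˡ (trans (^-congˡ t g^d≈ε) (ε^ t)) ⟩
    g ^ k ∙ ε              ≈⟨ identityʳ _ ⟩
    g ^ k                  ∎

  ^-∣ : ∀ {g d j} → g ^ d ≈ ε → d ∣ j → g ^ j ≈ ε
  ^-∣ {g} {d} g^d≈ε (divides t ≡.refl) = ^-periodic g^d≈ε 0 t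

  ^-cancel : ∀ {g a b} → a ≤ b → g ^ a ≈ g ^ b → g ^ (b ∸ a) ≈ ε
  ^-cancel {g} {a} {b} a≤b g^a≈g^b = identityʳ-unique (g ^ a) _ (begin
    g ^ a ∙ g ^ (b ∸ a)    ≈⟨ ^-homo-+ g a (b ∸ a) ⟨
    g ^ (a + (b ∸ a))      ≡⟨ ≡.cong (g ^_) (m+[n∸m]≡n a≤b) ⟩
    g ^ b                  ≈⟨ g^a≈g^b ⟨
    g ^ a                  ∎)

  minimal-period-∣ : ∀ {g m} .{{_ : NonZero m}} → g ^ m ≈ ε →
                     (∀ {r} → 0 < r → r < m → ¬ g ^ r ≈ ε) → ∀ {j} → g ^ j ≈ ε → m ∣ j
  minimal-period-∣ {g} {m} g^m≈ε minimal {j} g^j≈ε with j % m in j%m≡r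
  ... | zero  = m%n≡0⇒n∣m j m j%m≡r
  ... | suc r = contradiction (begin
    g ^ suc r                   ≡⟨ ≡.cong (g ^_) j%m≡r ⟨
    g ^ (j % m)                 ≈⟨ ^-periodic g^m≈ε (j % m) (j / m) ⟨
    g ^ (j % m + j / m * m)     ≡⟨ ≡.cong (g ^_) (m≡m%n+[m/n]*n j m) ⟨
    g ^ j                       ≈⟨ g^j≈ε ⟩
    ε                           ∎) (minimal (s≤s z≤n) (≡.subst (_< m) j%m≡r (m%n<n j m)))

  ^-period : ∀ {g d} → g ^ d ≈ ε → ∀ k → (g ^ k) ^ d ≈ ε
  ^-period {g} {d} g^d≈ε k = trans (sym (^-* g d k)) (^-∣ {g} {d} g^d≈ε (m∣m*n k))

  ⁻¹≈^pred : ∀ {g d} .{{_ : NonZero d}} → g ^ d ≈ ε → g ⁻¹ ≈ g ^ pred d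
  ⁻¹≈^pred {g} {d} g^d≈ε = sym (inverseʳ-unique g (g ^ pred d)
    (trans (reflexive (≡.cong (g ^_) (suc-pred d))) g^d≈ε))

  InCyc⇒^ : ∀ {g d x} .{{_ : NonZero d}} → g ^ d ≈ ε → InCyc G g x → ∃ λ a → x ≈ g ^ a
  InCyc⇒^         g^d≈ε (+ a , x≈g^a) = a , x≈g^a
  InCyc⇒^ {g} {d} {x} g^d≈ε (-[1+ a ] , x≈g^-a) = suc a * pred d , (begin
    x                       ≈⟨ x≈g^-a ⟩
    (g ^ suc a) ⁻¹          ≈⟨ ⁻¹≈^pred (^-period {g} {d} g^d≈ε (suc a)) ⟩
    (g ^ suc a) ^ pred d    ≈⟨ ^-* g (pred d) (suc a) ⟨
    g ^ (pred d * suc a)    ≡⟨ ≡.cong (g ^_) (*-comm (pred d) (suc a)) ⟩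
    g ^ (suc a * pred d)    ∎)

  InCyc-⊆ : ∀ {g h d b x} .{{_ : NonZero d}} → g ^ d ≈ ε → g ≈ h ^ b → InCyc G g x → InCyc G h x
  InCyc-⊆ {g} {h} {d} {b} {x} g^d≈ε g≈h^b x∈⟨g⟩ with a , x≈g^a ← InCyc⇒^ {g} {d} g^d≈ε x∈⟨g⟩ =
    + (a * b) , (begin
      x              ≈⟨ x≈g^a ⟩
      g ^ a          ≈⟨ ^-congˡ a g≈h^b ⟩
      (h ^ b) ^ a    ≈⟨ ^-* h a b ⟨
      h ^ (a * b)    ∎)

  InCyc-self : ∀ g → InCyc G g g
  InCyc-self g = + 1 , sym (identityʳ g)

  coprime⇒generator : ∀ {g d k} .{{_ : NonZero d}} → g ^ d ≈ ε → Coprime k d →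
                      ∃ λ b → g ≈ (g ^ k) ^ b
  coprime⇒generator {g} {d} {k} g^d≈ε k⊥d with coprime-Bézout k⊥d
  ... | Bézout.+- x y 1+yd≡xk = x , (begin
    g                   ≈⟨ identityʳ g ⟨
    g ^ 1               ≈⟨ ^-periodic g^d≈ε 1 y ⟨
    g ^ (1 + y * d)     ≡⟨ ≡.cong (g ^_) 1+yd≡xk ⟩
    g ^ (x * k)         ≈⟨ ^-* g x k ⟩
    (g ^ k) ^ x         ∎)
  ... | Bézout.-+ x y 1+xk≡yd = x * pred d , (begin
    g                         ≈⟨ inverseˡ-unique g ((g ^ k) ^ x) g∙g^kx≈ε ⟩
    ((g ^ k) ^ x) ⁻¹          ≈⟨ ⁻¹≈^pred (^-period {g ^ k} {d} (^-period {g} {d} g^d≈ε k) x) ⟩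
    ((g ^ k) ^ x) ^ pred d    ≈⟨ ^-* (g ^ k) (pred d) x ⟨
    (g ^ k) ^ (pred d * x)    ≡⟨ ≡.cong ((g ^ k) ^_) (*-comm (pred d) x) ⟩
    (g ^ k) ^ (x * pred d)    ∎)
    where
    g∙g^kx≈ε : g ∙ (g ^ k) ^ x ≈ ε
    g∙g^kx≈ε = begin
      g ∙ (g ^ k) ^ x    ≈⟨ ∙-congˡ (^-* g x k) ⟨
      g ^ (1 + x * k)    ≡⟨ ≡.cong (g ^_) 1+xk≡yd ⟩
      g ^ (y * d)        ≈⟨ ^-∣ {g} {d} g^d≈ε (n∣m*n y) ⟩
      ε                  ∎

  -- ExclEdge G H 𝒳 g h unfolds to InH g × InH h × ¬ (h ≈ g) × AdmissiblePower 𝒳 g h.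
  AdmissiblePower : List ℕ → Carrier → Carrier → Set ℓ
  AdmissiblePower 𝒳 g h = Σ ℕ λ k → k ≥ 1 × Admissible G 𝒳 k × h ≈ g ^ k

  period⇒admissiblePower : ∀ {𝒳 g h d k} → All Prime 𝒳 → g ^ d ≈ ε → k ≥ 1 → h ≈ g ^ k →
                           (∀ {q} → q ∈ 𝒳 → q ∣ k → q ∤ d) → AdmissiblePower 𝒳 g h
  period⇒admissiblePower {d = d} {k} primes g^d≈ε k≥1 h≈g^k coprime
    with t , avoids ← admissible-shift primes coprime =
    k + t * d , ≤-trans k≥1 (m≤m+n k (t * d)) , avoids , trans h≈g^k (sym (^-periodic g^d≈ε k t))

  two-powers⇒admissiblePower : ∀ {𝒳 g h a b} → All Prime 𝒳 → a ≥ 1 → b ≥ 1 → h ≈ g ^ a → h ≈ g ^ b →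
                               (∀ {q} → q ∈ 𝒳 → q ∣ a → q ∤ b) → AdmissiblePower 𝒳 g h
  two-powers⇒admissiblePower {a = a} {b} primes a≥1 b≥1 h≈g^a h≈g^b coprime with ≤-total a b
  ... | inj₁ a≤b = period⇒admissiblePower primes (^-cancel a≤b (trans (sym h≈g^a) h≈g^b)) a≥1 h≈g^a
                     λ q∈𝒳 q∣a q∣b∸a → coprime q∈𝒳 q∣a (∣m∸n∣n⇒∣m _ a≤b q∣b∸a q∣a)
  ... | inj₂ b≤a = period⇒admissiblePower primes (^-cancel b≤a (trans (sym h≈g^b) h≈g^a)) b≥1 h≈g^b
                     λ q∈𝒳 q∣b q∣a∸b → coprime q∈𝒳 (∣m∸n∣n⇒∣m _ b≤a q∣a∸b q∣b) q∣b

  mutual-powers⇒admissiblePower : ∀ {𝒳 g h} a b → All Prime 𝒳 → ¬ h ≈ g → h ≈ g ^ a → g ≈ h ^ b →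
                                  AdmissiblePower 𝒳 g h
  mutual-powers⇒admissiblePower zero b _ h≉g h≈ε g≈h^b =
    contradiction (trans h≈ε (sym (trans g≈h^b (trans (^-congˡ b h≈ε) (ε^ b))))) h≉g
  mutual-powers⇒admissiblePower (suc a) zero _ h≉g h≈g^a g≈ε =
    contradiction (trans h≈g^a (trans (^-congˡ (suc a) g≈ε) (trans (ε^ (suc a)) (sym g≈ε)))) h≉g
  mutual-powers⇒admissiblePower {𝒳} {g} {h} (suc a) (suc b) primes _ h≈g^a g≈h^b =
    period⇒admissiblePower primes (^-cancel {g} {1} {suc b * suc a} (s≤s z≤n) g^1≈g^ba)
      (s≤s z≤n) h≈g^a coprime
    where
    g^1≈g^ba : g ^ 1 ≈ g ^ (suc b * suc a)
    g^1≈g^ba = begin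
      g ^ 1                  ≈⟨ identityʳ g ⟩
      g                      ≈⟨ g≈h^b ⟩
      h ^ suc b              ≈⟨ ^-congˡ (suc b) h≈g^a ⟩
      (g ^ suc a) ^ suc b    ≈⟨ ^-* g (suc b) (suc a) ⟨
      g ^ (suc b * suc a)    ∎
    coprime : ∀ {q} → q ∈ 𝒳 → q ∣ suc a → q ∤ suc b * suc a ∸ 1
    coprime {q} q∈𝒳 q∣a q∣ba-1 = ¬prime[1] (≡.subst Prime q≡1 (All.lookup primes q∈𝒳))
      where
      q≡1 : q ≡ 1
      q≡1 = ∣1⇒≡1 (∣m+n∣m⇒∣n (≡.subst (q ∣_) (+-comm 1 _) (∣n⇒∣m*n (suc b) q∣a)) q∣ba-1)

  AdmissiblePower-++ : ∀ {𝒳 𝒴 g h} → All Prime 𝒳 → All Prime 𝒴 →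
                       AdmissiblePower (𝒳 ++ 𝒴) g h ⇔ (AdmissiblePower 𝒳 g h × AdmissiblePower 𝒴 g h)
  AdmissiblePower-++ {𝒳} {𝒴} primes𝒳 primes𝒴 = mk⇔
    (λ (k , k≥1 , admissible , h≈g^k) →
       (k , k≥1 , (λ q q∈𝒳 → admissible q (∈-++⁺ˡ q∈𝒳))   , h≈g^k) ,
       (k , k≥1 , (λ q q∈𝒴 → admissible q (∈-++⁺ʳ 𝒳 q∈𝒴)) , h≈g^k))
    (λ ((a , a≥1 , admissible𝒳 , h≈g^a) , (b , b≥1 , admissible𝒴 , h≈g^b)) →
       two-powers⇒admissiblePower (++⁺ primes𝒳 primes𝒴) a≥1 b≥1 h≈g^a h≈g^b λ q∈𝒳++𝒴 q∣a q∣b →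
         [ (λ q∈𝒳 → admissible𝒳 _ q∈𝒳 q∣a) , (λ q∈𝒴 → admissible𝒴 _ q∈𝒴 q∣b) ]′ (∈-++⁻ 𝒳 q∈𝒳++𝒴))

  module _ {p} (H : FiniteSubgroup G p) where
    open FiniteSubgroup H

    element : Fin order → Carrier
    element = lookup elems

    element∈H : ∀ i → InH (element i)
    element∈H i = elems-InH (∈-lookup i)

    index : ∀ {x} → InH x → Fin order
    index x∈H = Any.index (elems-cover x∈H)

    ≈element-index : ∀ {x} (x∈H : InH x) → x ≈ element (index x∈H)
    ≈element-index x∈H = lookup-index (elems-cover x∈H)

    ≡⇔element-≈ : ∀ {i j} → i ≡ j ⇔ element i ≈ element j
    ≡⇔element-≈ = mk⇔ (reflexive ∘ ≡.cong element) (lookup-injective setoid elems-distinct)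

    index-≡⇒≈ : ∀ {x y} (x∈H : InH x) (y∈H : InH y) → index x∈H ≡ index y∈H → x ≈ y
    index-≡⇒≈ x∈H y∈H same-index = begin
      _                      ≈⟨ ≈element-index x∈H ⟩
      element (index x∈H)    ≡⟨ ≡.cong element same-index ⟩
      element (index y∈H)    ≈⟨ ≈element-index y∈H ⟨
      _                      ∎

    ≈⇒index-≡ : ∀ {x y} (x∈H : InH x) (y∈H : InH y) → x ≈ y → index x∈H ≡ index y∈H
    ≈⇒index-≡ x∈H y∈H x≈y = Equivalence.from ≡⇔element-≈
      (trans (sym (≈element-index x∈H)) (trans x≈y (≈element-index y∈H)))

    ≈-dec : ∀ {x y} → InH x → InH y → Dec (x ≈ y)
    ≈-dec x∈H y∈H = Dec.map′ (index-≡⇒≈ x∈H y∈H) (≈⇒index-≡ x∈H y∈H) (index x∈H Fin.≟ index y∈H)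

    ^∈H : ∀ {g} → InH g → ∀ k → InH (g ^ k)
    ^∈H g∈H zero    = InH-ε
    ^∈H g∈H (suc k) = InH-∙ g∈H (^∈H g∈H k)

    ∃-period : ∀ {g} → InH g → ∃ λ d → d ≥ 1 × g ^ d ≈ ε
    ∃-period {g} g∈H
      with i , j , i<j , same-index ← pigeonhole (n<1+n order) (λ j → index (^∈H g∈H (Fin.toℕ j))) =
      Fin.toℕ j ∸ Fin.toℕ i , m<n⇒0<n∸m i<j ,
      ^-cancel (<⇒≤ i<j) (index-≡⇒≈ (^∈H g∈H (Fin.toℕ i)) (^∈H g∈H (Fin.toℕ j)) same-index)

    period? : ∀ {g} → InH g → ∀ d → Dec (d ≥ 1 × g ^ d ≈ ε)
    period? g∈H d = (1 ≤? d) Dec.×-dec ≈-dec (^∈H g∈H d) InH-ε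

    ∃-least-period : ∀ {g} → InH g → ∃ λ m → m ≥ 1 × (∀ j → g ^ j ≈ ε ⇔ m ∣ j)
    ∃-least-period {g} g∈H
      with _ , period ← ∃-period g∈H
      with m , (m≥1 , g^m≈ε) , smaller-not-period ← least-witness (period? g∈H) period =
      m , m≥1 , λ j → mk⇔
        (minimal-period-∣ {{>-nonZero m≥1}} g^m≈ε
           λ 0<r r<m g^r≈ε → smaller-not-period r<m (0<r , g^r≈ε))
        (^-∣ {g} {m} {j} g^m≈ε)

    module RightTranslation {g} (g∈H : InH g) where

      translate : Fin order → ℕ → Fin order
      translate i j = index (InH-∙ (element∈H i) (^∈H g∈H j))

      element-translate : ∀ i j → element (translate i j) ≈ element i ∙ g ^ j
      element-translate i j = sym (≈element-index (InH-∙ (element∈H i) (^∈H g∈H j)))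

      translate-+ : ∀ i j k → translate (translate i j) k ≡ translate i (j + k)
      translate-+ i j k = Equivalence.from ≡⇔element-≈ (begin
        element (translate (translate i j) k)  ≈⟨ element-translate (translate i j) k ⟩
        element (translate i j) ∙ g ^ k        ≈⟨ ∙-congʳ (element-translate i j) ⟩
        (element i ∙ g ^ j) ∙ g ^ k            ≈⟨ assoc _ _ _ ⟩
        element i ∙ (g ^ j ∙ g ^ k)            ≈⟨ ∙-congˡ (^-homo-+ g j k) ⟨
        element i ∙ g ^ (j + k)                ≈⟨ element-translate i (j + k) ⟨
        element (translate i (j + k))          ∎)

      translate≡⇔^≈ε : ∀ i j → translate i j ≡ i ⇔ g ^ j ≈ ε
      translate≡⇔^≈ε i j = mk⇔
        (λ fixed → identityʳ-unique (element i) (g ^ j)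
                     (trans (sym (element-translate i j)) (Equivalence.to ≡⇔element-≈ fixed)))
        (λ g^j≈ε → Equivalence.from ≡⇔element-≈
                     (trans (element-translate i j) (trans (∙-congˡ g^j≈ε) (identityʳ _))))

    ^order≈ε : ∀ {g} → InH g → g ^ order ≈ ε
    ^order≈ε g∈H with m , m≥1 , period⇔ ← ∃-least-period g∈H =
      Equivalence.from (period⇔ order)
        (FreeAction.m∣n {{>-nonZero m≥1}} translate translate-+
           λ i j → ⇔-trans (translate≡⇔^≈ε i j) (period⇔ j))
      where open RightTranslation g∈H

    instance
      order-nonZero : NonZero order
      order-nonZero = nonZeroIndex (index InH-ε)

    ExclEdge⇔PowEdge : ∀ {𝒳} → All Prime 𝒳 → (∀ q → Prime q → q ∣ order → q ∉ 𝒳) →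
                       ∀ g h → ExclEdge G H 𝒳 g h ⇔ PowEdge G H g h
    ExclEdge⇔PowEdge primes order-avoids-𝒳 g h = mk⇔
      (λ (g∈H , h∈H , h≉g , k , k≥1 , _ , h≈g^k) → g∈H , h∈H , h≉g , k , k≥1 , h≈g^k)
      (λ (g∈H , h∈H , h≉g , k , k≥1 , h≈g^k) → g∈H , h∈H , h≉g ,
         period⇒admissiblePower primes (^order≈ε g∈H) k≥1 h≈g^k
           λ q∈𝒳 _ q∣order → order-avoids-𝒳 _ (All.lookup primes q∈𝒳) q∣order q∈𝒳)

    mutual-powers⇒SameCyclic : ∀ {g h a b} → InH g → InH h → h ≈ g ^ a → g ≈ h ^ b → SameCyclic G g h
    mutual-powers⇒SameCyclic {a = a} {b} g∈H h∈H h≈g^a g≈h^b x =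
      InCyc-⊆ {b = b} (^order≈ε g∈H) g≈h^b , InCyc-⊆ {b = a} (^order≈ε h∈H) h≈g^a

    ExclEdge⇔SameCyclic : ∀ {𝒳} → All Prime 𝒳 → (∀ q → Prime q → q ∣ order → q ∈ 𝒳) →
                          ∀ g h → ExclEdge G H 𝒳 g h ⇔ (InH g × InH h × ¬ (h ≈ g) × SameCyclic G g h)
    ExclEdge⇔SameCyclic {𝒳} primes order-within-𝒳 g h = mk⇔
      (λ (g∈H , h∈H , h≉g , k , _ , admissible , h≈g^k) → g∈H , h∈H , h≉g ,
         let b , g≈g^k^b = coprime⇒generator (^order≈ε g∈H) (k⊥order admissible)
         in mutual-powers⇒SameCyclic {a = k} {b} g∈H h∈H h≈g^k
              (trans g≈g^k^b (^-congˡ b (sym h≈g^k))))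
      (λ (g∈H , h∈H , h≉g , ⟨g⟩≡⟨h⟩) → g∈H , h∈H , h≉g ,
         let a , h≈g^a = InCyc⇒^ (^order≈ε g∈H) (proj₂ (⟨g⟩≡⟨h⟩ h) (InCyc-self h))
             b , g≈h^b = InCyc⇒^ (^order≈ε h∈H) (proj₁ (⟨g⟩≡⟨h⟩ g) (InCyc-self g))
         in mutual-powers⇒admissiblePower a b primes h≉g h≈g^a g≈h^b)
      where
      k⊥order : ∀ {k} → Admissible G 𝒳 k → Coprime k order
      k⊥order admissible = no-common-prime⇒coprime λ q-prime q∣k q∣order →
        admissible _ (order-within-𝒳 _ q-prime q∣order) q∣k

    ExclEdge-++⇔× : ∀ {𝒳 𝒴} → All Prime 𝒳 → All Prime 𝒴 →
                    ∀ g h → ExclEdge G H (𝒳 ++ 𝒴) g h ⇔ (ExclEdge G H 𝒳 g h × ExclEdge G H 𝒴 g h)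
    ExclEdge-++⇔× primes𝒳 primes𝒴 g h = mk⇔
      (λ (g∈H , h∈H , h≉g , power) → let power𝒳 , power𝒴 = to power in
         (g∈H , h∈H , h≉g , power𝒳) , (g∈H , h∈H , h≉g , power𝒴))
      (λ ((g∈H , h∈H , h≉g , power𝒳) , (_ , _ , _ , power𝒴)) →
         g∈H , h∈H , h≉g , from (power𝒳 , power𝒴))
      where open Equivalence (AdmissiblePower-++ {g = g} {h} primes𝒳 primes𝒴)

lemma3p3 : ∀ {c ℓ p : Level} (G : Group c ℓ) (H : FiniteSubgroup G p)
             (𝒳 𝒴 : List ℕ) → All Prime 𝒳 → All Prime 𝒴 →
             ((∀ q → Prime q → q ∣ FiniteSubgroup.order H → q ∉ 𝒳) →
                ∀ g h → ExclEdge G H 𝒳 g h ⇔ PowEdge G H g h)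
             × ((∀ q → Prime q → q ∣ FiniteSubgroup.order H → q ∈ 𝒳) →
                ∀ g h → ExclEdge G H 𝒳 g h
                  ⇔ (FiniteSubgroup.InH H g × FiniteSubgroup.InH H h
                     × ¬ (Group._≈_ G h g) × SameCyclic G g h))
             × (∀ g h → ExclEdge G H (𝒳 ++ 𝒴) g h
                  ⇔ (ExclEdge G H 𝒳 g h × ExclEdge G H 𝒴 g h))
lemma3p3 G H 𝒳 𝒴 primes𝒳 primes𝒴 =
  ExclEdge⇔PowEdge G H primes𝒳 , ExclEdge⇔SameCyclic G H primes𝒳 , ExclEdge-++⇔× G H primes𝒳 primes𝒴
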